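{- Let $m=2h+1$ be a positive odd integer, $q=3^m$ and $\alpha=3^{(m+1)/2}$. Then for each integer $a$ with $0\le a\le q-2$, $$s(a)+s\!\left(\frac{q-1}{2}-a(\alpha+2)\right)\ge m.$$
   Context: For an integer $a$ not divisible by $q-1$, let $L(a)$ be the least positive integer congruent to $a$ modulo $q-1$, write $L(a)=a_0+a_1 3+\cdots+a_{m-1}3^{m-1}$ with $0\le a_i\le 2$, and define the digit sum $s(a)=a_0+a_1+\cdots+a_{m-1}$. For integers $a$ divisible by $q-1$, set $s(a)=0$. -}

module Defs where

open import Data.Nat using (ℕ; zero; suc; _+_; _^_; _∸_)
open import Data.Nat.DivMod using (_%_; _/_)
open import Data.Integer using (ℤ; _%ℕ_)

digitSum3 : ℕ → ℕ → ℕ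
digitSum3 zero    n = 0
digitSum3 (suc k) n = n % 3 + digitSum3 k (n / 3)

-- The digit sum s(a) relative to q = 3^m (modulus q - 1).
-- r = a mod (q-1) ∈ [0, q-2].  If r = 0 then (q-1) ∣ a and s(a) = 0;
-- otherwise L(a) = r < 3^m and s(a) is the sum of its m base-3 digits.
-- (The case q - 1 = 0, i.e. m = 0, is degenerate and never used.)
s : (m : ℕ) → ℤ → ℕ
s m a = go (3 ^ m ∸ 1)
  where
  go : ℕ → ℕ
  go zero    = 0
  go (suc n) with a %ℕ suc n
  ... | zero  = 0
  ... | suc r = digitSum3 m (suc r)

{-# OPTIONS --safe #-}
module Submission where

-- Write s for the base-3 digit sum of the least residue modulo q − 1 = 3^m − 1. It is
-- subadditive (carries only lower digit sums, and reducing modulo q − 1 is an end-around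
-- carry), multiplication by 3 does not increase it (modulo 3^m − 1 it rotates the m digits),
-- and s(y + (q−1)/2) + s(y) = s(2y) + m, because adding (q−1)/2 = 11…1₃ and doubling produce
-- the same carries digit by digit. For b ≡ (q−1)/2 − a(α+2) one has 3^h(a + 2b) ≡ b + (q−1)/2
-- modulo q − 1, as 3 · 3^(2h) = q ≡ 1; hence
--   s(2b) + m = s(b + (q−1)/2) + s(b) ≤ s(a + 2b) + s(b) ≤ s(a) + s(2b) + s(b).

open import Defs
open import Data.Nat as N using (ℕ; _≤_; _≥_; _∸_; _^_; _/_)
open import Data.Integer as Z using (+_)

module DigitSum where
  open import Data.Nat
  open import Data.Nat.Properties
  open import Data.Nat.DivMod
  open import Data.Nat.Divisibility using (divides-refl)
  open import Data.Nat.Tactic.RingSolver using (solve-∀)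
  open import Data.Product using (_×_; _,_)
  open import Algebra.Properties.CommutativeSemigroup +-commutativeSemigroup using (interchange)
  open import Relation.Binary.PropositionalEquality

  m%n+m/n≤m : ∀ m n .{{_ : NonZero n}} → m % n + m / n ≤ m
  m%n+m/n≤m m n = begin
    m % n + m / n      ≤⟨ +-monoʳ-≤ (m % n) (m≤m*n (m / n) n) ⟩
    m % n + m / n * n  ≡⟨ m≡m%n+[m/n]*n m n ⟨
    m                  ∎
    where open ≤-Reasoning

  m+n*o<n*p⇒o<p : ∀ m n o p → m + n * o < n * p → o < p
  m+n*o<n*p⇒o<p m n o p lt = *-cancelˡ-< n o p (≤-<-trans (m≤n+m (n * o) m) lt)

  digitSum3-0 : ∀ k → digitSum3 k 0 ≡ 0
  digitSum3-0 zero    = refl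
  digitSum3-0 (suc k) = digitSum3-0 k

  digitSum3-carry : ∀ k u y → digitSum3 (suc k) (u + 3 * y) ≡ u % 3 + digitSum3 k (u / 3 + y)
  digitSum3-carry k u y = cong₂ (λ t q → t + digitSum3 k q) lowDigit rest
    where
    u+3y≡u+y*3 : u + 3 * y ≡ u + y * 3
    u+3y≡u+y*3 = cong (_+_ u) (*-comm 3 y)
    lowDigit : (u + 3 * y) % 3 ≡ u % 3
    lowDigit = trans (cong (_% 3) u+3y≡u+y*3) ([m+kn]%n≡m%n u y 3)
    rest : (u + 3 * y) / 3 ≡ u / 3 + y
    rest = trans (cong (_/ 3) u+3y≡u+y*3)
                 (trans (+-distrib-/-∣ʳ u (divides-refl y)) (cong (_+_ (u / 3)) (m*n/n≡m y 3)))

  digitSum3-step : ∀ k {d} q → d < 3 → digitSum3 (suc k) (d + 3 * q) ≡ d + digitSum3 k q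
  digitSum3-step k {d} q d<3 = trans (digitSum3-carry k d q)
    (cong₂ (λ t e → t + digitSum3 k (e + q)) (m<n⇒m%n≡m d<3) (m<n⇒m/n≡0 d<3))

  data Base3 : ℕ → Set where
    digit+3* : ∀ d q → d < 3 → Base3 (d + 3 * q)

  base3 : ∀ x → Base3 x
  base3 x = subst Base3 (sym x≡) (digit+3* (x % 3) (x / 3) (m%n<n x 3))
    where
    x≡ : x ≡ x % 3 + 3 * (x / 3)
    x≡ = trans (m≡m%n+[m/n]*n x 3) (cong (_+_ (x % 3)) (*-comm (x / 3) 3))

  digitSum3-≤ : ∀ k n → digitSum3 k n ≤ n
  digitSum3-≤ zero    n = z≤n
  digitSum3-≤ (suc k) n with base3 n
  ... | digit+3* d q d<3 = begin
    digitSum3 (suc k) (d + 3 * q)  ≡⟨ digitSum3-step k q d<3 ⟩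
    d + digitSum3 k q              ≤⟨ +-monoʳ-≤ d (≤-trans (digitSum3-≤ k q) (m≤n*m q 3)) ⟩
    d + 3 * q                      ∎
    where open ≤-Reasoning

  digitSum3-+-≤ : ∀ k x y → digitSum3 k (x + y) ≤ digitSum3 k x + digitSum3 k y
  digitSum3-+-≤ zero    x y = z≤n
  digitSum3-+-≤ (suc k) x y with base3 x | base3 y
  ... | digit+3* x₀ x′ x₀<3 | digit+3* y₀ y′ y₀<3 = begin
    ds (suc k) (x₀ + 3 * x′ + (y₀ + 3 * y′))
      ≡⟨ cong (ds (suc k)) (regroup x₀ x′ y₀ y′) ⟩
    ds (suc k) (t + 3 * (x′ + y′))
      ≡⟨ digitSum3-carry k t (x′ + y′) ⟩
    t % 3 + ds k (t / 3 + (x′ + y′))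
      ≤⟨ +-monoʳ-≤ (t % 3) (digitSum3-+-≤ k (t / 3) (x′ + y′)) ⟩
    t % 3 + (ds k (t / 3) + ds k (x′ + y′))
      ≤⟨ +-monoʳ-≤ (t % 3) (+-mono-≤ (digitSum3-≤ k (t / 3)) (digitSum3-+-≤ k x′ y′)) ⟩
    t % 3 + (t / 3 + (ds k x′ + ds k y′))
      ≡⟨ +-assoc (t % 3) (t / 3) _ ⟨
    t % 3 + t / 3 + (ds k x′ + ds k y′)
      ≤⟨ +-monoˡ-≤ _ (m%n+m/n≤m t 3) ⟩
    x₀ + y₀ + (ds k x′ + ds k y′)
      ≡⟨ interchange x₀ y₀ _ _ ⟩
    x₀ + ds k x′ + (y₀ + ds k y′)
      ≡⟨ cong₂ _+_ (digitSum3-step k x′ x₀<3) (digitSum3-step k y′ y₀<3) ⟨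
    ds (suc k) (x₀ + 3 * x′) + ds (suc k) (y₀ + 3 * y′)
      ∎
    where
    open ≤-Reasoning
    ds = digitSum3
    t = x₀ + y₀
    regroup : ∀ a b c d → a + 3 * b + (c + 3 * d) ≡ a + c + 3 * (b + d)
    regroup = solve-∀

  digitSum3-suc-≤ : ∀ k i → digitSum3 k (suc i) ≤ digitSum3 k i + 1
  digitSum3-suc-≤ k i = begin
    digitSum3 k (suc i)            ≡⟨ cong (digitSum3 k) (+-comm 1 i) ⟩
    digitSum3 k (i + 1)            ≤⟨ digitSum3-+-≤ k i 1 ⟩
    digitSum3 k i + digitSum3 k 1  ≤⟨ +-monoʳ-≤ (digitSum3 k i) (digitSum3-≤ k 1) ⟩
    digitSum3 k i + 1              ∎
    where open ≤-Reasoning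

  digitSum3-top : ∀ k u d → u < 3 ^ k → d < 3 → digitSum3 (suc k) (u + 3 ^ k * d) ≡ digitSum3 k u + d
  digitSum3-top zero zero d _ d<3 =
    trans (+-identityʳ _) (trans (cong (_% 3) (+-identityʳ d)) (m<n⇒m%n≡m d<3))
  digitSum3-top zero (suc u) d (s≤s ()) _
  digitSum3-top (suc k) u d u<3^k d<3 with base3 u
  ... | digit+3* u₀ u′ u₀<3 = begin
    ds (2 + k) (u₀ + 3 * u′ + 3 ^ suc k * d)  ≡⟨ cong (ds (2 + k)) (regroup u₀ u′ (3 ^ k) d) ⟩
    ds (2 + k) (u₀ + 3 * (u′ + 3 ^ k * d))    ≡⟨ digitSum3-step (suc k) (u′ + 3 ^ k * d) u₀<3 ⟩
    u₀ + ds (suc k) (u′ + 3 ^ k * d)          ≡⟨ cong (_+_ u₀) (digitSum3-top k u′ d u′<3^k d<3) ⟩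
    u₀ + (ds k u′ + d)                        ≡⟨ +-assoc u₀ _ d ⟨
    u₀ + ds k u′ + d                          ≡⟨ cong (_+ d) (digitSum3-step k u′ u₀<3) ⟨
    ds (suc k) (u₀ + 3 * u′) + d              ∎
    where
    open ≡-Reasoning
    ds = digitSum3
    u′<3^k : u′ < 3 ^ k
    u′<3^k = m+n*o<n*p⇒o<p u₀ 3 u′ (3 ^ k) u<3^k
    regroup : ∀ a b p d → a + 3 * b + 3 * p * d ≡ a + 3 * (b + p * d)
    regroup = solve-∀

  digitSum3-extend : ∀ k u → u < 3 ^ k → digitSum3 (suc k) u ≡ digitSum3 k u
  digitSum3-extend k u u<3^k = begin
    digitSum3 (suc k) u                ≡⟨ cong (digitSum3 (suc k)) u+0≡u ⟨
    digitSum3 (suc k) (u + 3 ^ k * 0)  ≡⟨ digitSum3-top k u 0 u<3^k z<s ⟩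
    digitSum3 k u + 0                  ≡⟨ +-identityʳ _ ⟩
    digitSum3 k u                      ∎
    where
    open ≡-Reasoning
    u+0≡u : u + 3 ^ k * 0 ≡ u
    u+0≡u = trans (cong (_+_ u) (*-zeroʳ (3 ^ k))) (+-identityʳ u)

  repunit : ℕ → ℕ
  repunit zero    = 0
  repunit (suc k) = 1 + 3 * repunit k

  1+[repunit+repunit]≡3^ : ∀ k → 1 + (repunit k + repunit k) ≡ 3 ^ k
  1+[repunit+repunit]≡3^ zero    = refl
  1+[repunit+repunit]≡3^ (suc k) = trans (regroup (repunit k)) (cong (3 *_) (1+[repunit+repunit]≡3^ k))
    where
    regroup : ∀ r → 1 + (1 + 3 * r + (1 + 3 * r)) ≡ 3 * (1 + (r + r))
    regroup = solve-∀

  digitSum3-repunit : ∀ k → digitSum3 k (repunit k) ≡ k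
  digitSum3-repunit zero    = refl
  digitSum3-repunit (suc k) =
    trans (digitSum3-step k (repunit k) (s≤s (s≤s z≤n))) (cong suc (digitSum3-repunit k))

  repunit-digit : ∀ {d c} → d < 3 → c ≤ 1 →
    (c + d + 1) / 3 ≡ (c + 2 * d) / 3 × (c + d + 1) / 3 ≤ 1 × (c + d + 1) % 3 + d ≡ (c + 2 * d) % 3 + 1
  repunit-digit {0} _ z≤n       = refl , z≤n , refl
  repunit-digit {0} _ (s≤s z≤n) = refl , z≤n , refl
  repunit-digit {1} _ z≤n       = refl , z≤n , refl
  repunit-digit {1} _ (s≤s z≤n) = refl , s≤s z≤n , refl
  repunit-digit {2} _ z≤n       = refl , s≤s z≤n , refl
  repunit-digit {2} _ (s≤s z≤n) = refl , s≤s z≤n , refl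
  repunit-digit {suc (suc (suc _))} (s≤s (s≤s (s≤s ()))) _

  digitSum3-+repunit : ∀ k c x → c ≤ 1 → x < 3 ^ k →
    digitSum3 (suc k) (c + (x + repunit k)) + digitSum3 k x ≡ digitSum3 (suc k) (c + 2 * x) + k
  digitSum3-+repunit zero    c zero    _   _        = refl
  digitSum3-+repunit zero    c (suc x) _   (s≤s ())
  digitSum3-+repunit (suc k) c x       c≤1 x<3^k with base3 x
  ... | digit+3* d x′ d<3 with repunit-digit d<3 c≤1
  ... | sameCarry , carry≤1 , lastDigits = begin
    ds (2 + k) (c + (d + 3 * x′ + repunit (suc k))) + ds (suc k) (d + 3 * x′)
      ≡⟨ cong₂ _+_ (trans (cong (ds (2 + k)) (regroup₁ c d x′ R)) (digitSum3-carry (suc k) u (x′ + R)))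
                   (digitSum3-step k x′ d<3) ⟩
    u % 3 + ds (suc k) (u / 3 + (x′ + R)) + (d + ds k x′)
      ≡⟨ interchange (u % 3) _ d _ ⟩
    u % 3 + d + (ds (suc k) (u / 3 + (x′ + R)) + ds k x′)
      ≡⟨ cong₂ _+_ lastDigits (digitSum3-+repunit k (u / 3) x′ carry≤1 x′<3^k) ⟩
    v % 3 + 1 + (ds (suc k) (u / 3 + 2 * x′) + k)
      ≡⟨ cong (λ e → v % 3 + 1 + (ds (suc k) (e + 2 * x′) + k)) sameCarry ⟩
    v % 3 + 1 + (ds (suc k) (v / 3 + 2 * x′) + k)
      ≡⟨ shuffle (v % 3) _ k ⟩
    v % 3 + ds (suc k) (v / 3 + 2 * x′) + suc k
      ≡⟨ cong (_+ suc k) (digitSum3-carry (suc k) v (2 * x′)) ⟨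
    ds (2 + k) (v + 3 * (2 * x′)) + suc k
      ≡⟨ cong (λ n → ds (2 + k) n + suc k) (regroup₂ c d x′) ⟨
    ds (2 + k) (c + 2 * (d + 3 * x′)) + suc k
      ∎
    where
    open ≡-Reasoning
    ds = digitSum3
    R = repunit k
    u = c + d + 1
    v = c + 2 * d
    x′<3^k : x′ < 3 ^ k
    x′<3^k = m+n*o<n*p⇒o<p d 3 x′ (3 ^ k) x<3^k
    regroup₁ : ∀ c d x r → c + (d + 3 * x + (1 + 3 * r)) ≡ c + d + 1 + 3 * (x + r)
    regroup₁ = solve-∀
    regroup₂ : ∀ c d x → c + 2 * (d + 3 * x) ≡ c + 2 * d + 3 * (2 * x)
    regroup₂ = solve-∀
    shuffle : ∀ a b k → a + 1 + (b + k) ≡ a + b + suc k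
    shuffle = solve-∀

module CyclicDigitSum (k : ℕ) where
  open DigitSum
  open import Data.Nat
  open import Data.Nat.Properties
  open import Data.Nat.DivMod
  open import Data.Nat.Tactic.RingSolver using (solve-∀)
  open import Data.Sum using (inj₁; inj₂)
  open import Algebra.Properties.CommutativeSemigroup +-commutativeSemigroup using (xy∙z≈y∙xz)
  open import Relation.Binary.Definitions using (tri<; tri≈; tri>)
  open import Relation.Binary.PropositionalEquality
  open import Relation.Nullary using (yes; no)

  [m*[n%d]]%d≡[m*n]%d : ∀ m n d .{{_ : NonZero d}} → (m * (n % d)) % d ≡ (m * n) % d
  [m*[n%d]]%d≡[m*n]%d m n d = begin
    (m * (n % d)) % d          ≡⟨ %-distribˡ-* m (n % d) d ⟩
    (m % d * (n % d % d)) % d  ≡⟨ cong (λ v → (m % d * v) % d) (m%n%n≡m%n n d) ⟩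
    (m % d * (n % d)) % d      ≡⟨ %-distribˡ-* m n d ⟨
    (m * n) % d                ∎
    where open ≡-Reasoning

  m : ℕ
  m = suc k

  half : ℕ
  half = repunit m

  q-1 : ℕ
  q-1 = half + half

  3^m≡1+[q-1] : 3 ^ m ≡ suc q-1
  3^m≡1+[q-1] = sym (1+[repunit+repunit]≡3^ m)

  q-1<3^m : q-1 < 3 ^ m
  q-1<3^m = ≤-reflexive (sym 3^m≡1+[q-1])

  3^m∸1≡q-1 : 3 ^ m ∸ 1 ≡ q-1
  3^m∸1≡q-1 = cong (_∸ 1) 3^m≡1+[q-1]

  [3^m∸1]/2≡half : (3 ^ m ∸ 1) / 2 ≡ half
  [3^m∸1]/2≡half = trans (cong (_/ 2) 3^m∸1≡half*2) (m*n/n≡m half 2)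
    where
    3^m∸1≡half*2 : 3 ^ m ∸ 1 ≡ half * 2
    3^m∸1≡half*2 = trans 3^m∸1≡q-1 (trans (cong (_+_ half) (sym (+-identityʳ half))) (*-comm 2 half))

  digitSumMod : ℕ → ℕ
  digitSumMod y = digitSum3 m (y % q-1)

  digitSumMod-residue : ∀ r → r < q-1 → digitSumMod r ≡ digitSum3 m r
  digitSumMod-residue r r<q-1 = cong (digitSum3 m) (m<n⇒m%n≡m r<q-1)

  digitSumMod-[q-1]≡0 : digitSumMod q-1 ≡ 0
  digitSumMod-[q-1]≡0 = trans (cong (digitSum3 m) (n%n≡0 q-1)) (digitSum3-0 m)

  digitSumMod-+[q-1] : ∀ j → j < q-1 → digitSumMod (j + q-1) ≡ digitSum3 m j
  digitSumMod-+[q-1] j j<q-1 = trans (cong (digitSum3 m) ([m+n]%n≡m%n j q-1)) (digitSumMod-residue j j<q-1)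

  digitSumMod-≤ : ∀ x → x ≤ q-1 → digitSumMod x ≤ digitSum3 m x
  digitSumMod-≤ x x≤q-1 with m≤n⇒m<n∨m≡n x≤q-1
  ... | inj₁ x<q-1 = ≤-reflexive (digitSumMod-residue x x<q-1)
  ... | inj₂ refl  = subst (_≤ digitSum3 m q-1) (sym digitSumMod-[q-1]≡0) z≤n

  digitSumMod-≤-digitSum3 : ∀ x → x < q-1 + q-1 → digitSumMod x ≤ digitSum3 (suc m) x
  digitSumMod-≤-digitSum3 x x<2[q-1] with x ≤? q-1
  ... | yes x≤q-1 = ≤-trans (digitSumMod-≤ x x≤q-1)
                            (≤-reflexive (sym (digitSum3-extend m x (≤-<-trans x≤q-1 q-1<3^m))))
  ... | no  x≰q-1 = begin
    digitSumMod x                        ≡⟨ cong digitSumMod x≡1+i+[q-1] ⟩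
    digitSumMod (suc i + q-1)            ≡⟨ digitSumMod-+[q-1] (suc i) 1+i<q-1 ⟩
    digitSum3 m (suc i)                  ≤⟨ digitSum3-suc-≤ m i ⟩
    digitSum3 m i + 1                    ≡⟨ digitSum3-top m i 1 i<3^m (s≤s (s≤s z≤n)) ⟨
    digitSum3 (suc m) (i + 3 ^ m * 1)    ≡⟨ cong (digitSum3 (suc m)) i+3^m≡x ⟩
    digitSum3 (suc m) x                  ∎
    where
    open ≤-Reasoning
    i = x ∸ suc q-1
    1+[q-1]+i≡x : suc q-1 + i ≡ x
    1+[q-1]+i≡x = m+[n∸m]≡n (≰⇒> x≰q-1)
    x≡1+i+[q-1] : x ≡ suc i + q-1
    x≡1+i+[q-1] = trans (sym 1+[q-1]+i≡x) (cong suc (+-comm q-1 i))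
    1+i<q-1 : suc i < q-1
    1+i<q-1 = +-cancelʳ-< q-1 (suc i) q-1 (subst (_< q-1 + q-1) x≡1+i+[q-1] x<2[q-1])
    i<3^m : i < 3 ^ m
    i<3^m = <-trans (<-trans (n<1+n i) 1+i<q-1) q-1<3^m
    i+3^m≡x : i + 3 ^ m * 1 ≡ x
    i+3^m≡x = trans (cong (_+_ i) (trans (*-identityʳ (3 ^ m)) 3^m≡1+[q-1]))
                    (trans (+-comm i (suc q-1)) 1+[q-1]+i≡x)

  digitSum3-extend-% : ∀ y → digitSum3 (suc m) (y % q-1) ≡ digitSumMod y
  digitSum3-extend-% y = digitSum3-extend m (y % q-1) (<-trans (m%n<n y q-1) q-1<3^m)

  digitSumMod-+-≤ : ∀ x y → digitSumMod (x + y) ≤ digitSumMod x + digitSumMod y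
  digitSumMod-+-≤ x y = begin
    digitSumMod (x + y)
      ≡⟨ cong (digitSum3 m) (%-distribˡ-+ x y q-1) ⟩
    digitSumMod (x % q-1 + y % q-1)
      ≤⟨ digitSumMod-≤-digitSum3 _ (+-mono-< (m%n<n x q-1) (m%n<n y q-1)) ⟩
    digitSum3 (suc m) (x % q-1 + y % q-1)
      ≤⟨ digitSum3-+-≤ (suc m) (x % q-1) (y % q-1) ⟩
    digitSum3 (suc m) (x % q-1) + digitSum3 (suc m) (y % q-1)
      ≡⟨ cong₂ _+_ (digitSum3-extend-% x) (digitSum3-extend-% y) ⟩
    digitSumMod x + digitSumMod y
      ∎
    where open ≤-Reasoning

  digitSumMod-3*-≤-digitSum3 : ∀ r → r < 3 ^ m → digitSumMod (3 * r) ≤ digitSum3 m r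
  digitSumMod-3*-≤-digitSum3 r r<3^m = begin
    digitSumMod (3 * r)                ≡⟨ cong digitSumMod 3r≡ ⟩
    digitSumMod (d + 3 * u + d * q-1)  ≡⟨ cong (digitSum3 m) ([m+kn]%n≡m%n (d + 3 * u) d q-1) ⟩
    digitSumMod (d + 3 * u)            ≤⟨ digitSumMod-≤ (d + 3 * u) rotated≤q-1 ⟩
    digitSum3 m (d + 3 * u)            ≡⟨ digitSum3-step k u d<3 ⟩
    d + digitSum3 k u                  ≡⟨ +-comm d _ ⟩
    digitSum3 k u + d                  ≡⟨ digitSum3-top k u d u<P d<3 ⟨
    digitSum3 m (u + P * d)            ≡⟨ cong (digitSum3 m) r≡ ⟨
    digitSum3 m r                      ∎
    where
    open ≤-Reasoning
    P = 3 ^ k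
    instance
      P-nonZero : NonZero P
      P-nonZero = m^n≢0 3 k
    u = r % P
    d = r / P
    u<P : u < P
    u<P = m%n<n r P
    d<3 : d < 3
    d<3 = m<n*o⇒m/o<n r<3^m
    r≡ : r ≡ u + P * d
    r≡ = trans (m≡m%n+[m/n]*n r P) (cong (_+_ u) (*-comm d P))
    3r≡ : 3 * r ≡ d + 3 * u + d * q-1
    3r≡ = begin-equality
      3 * r                ≡⟨ cong (3 *_) r≡ ⟩
      3 * (u + P * d)      ≡⟨ distrib u P d ⟩
      3 * u + 3 * P * d    ≡⟨ cong (λ p → 3 * u + p * d) 3^m≡1+[q-1] ⟩
      3 * u + suc q-1 * d  ≡⟨ regroup u d q-1 ⟩
      d + 3 * u + d * q-1  ∎
      where
      distrib : ∀ u p d → 3 * (u + p * d) ≡ 3 * u + 3 * p * d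
      distrib = solve-∀
      regroup : ∀ u d n → 3 * u + suc n * d ≡ d + 3 * u + d * n
      regroup = solve-∀
    rotated≤q-1 : d + 3 * u ≤ q-1
    rotated≤q-1 = s≤s⁻¹ (begin-strict
      d + 3 * u  <⟨ +-monoˡ-< (3 * u) d<3 ⟩
      3 + 3 * u  ≡⟨ *-suc 3 u ⟨
      3 * suc u  ≤⟨ *-monoʳ-≤ 3 u<P ⟩
      3 * P      ≡⟨ 3^m≡1+[q-1] ⟩
      suc q-1    ∎)

  digitSumMod-3*-≤ : ∀ y → digitSumMod (3 * y) ≤ digitSumMod y
  digitSumMod-3*-≤ y = begin
    digitSumMod (3 * y)          ≡⟨ cong (digitSum3 m) ([m*[n%d]]%d≡[m*n]%d 3 y q-1) ⟨
    digitSumMod (3 * (y % q-1))  ≤⟨ digitSumMod-3*-≤-digitSum3 (y % q-1) (<-trans (m%n<n y q-1) q-1<3^m) ⟩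
    digitSumMod y                ∎
    where open ≤-Reasoning

  digitSumMod-3^*-≤ : ∀ j y → digitSumMod (3 ^ j * y) ≤ digitSumMod y
  digitSumMod-3^*-≤ zero    y = ≤-reflexive (cong digitSumMod (*-identityˡ y))
  digitSumMod-3^*-≤ (suc j) y = begin
    digitSumMod (3 * 3 ^ j * y)    ≡⟨ cong digitSumMod (*-assoc 3 (3 ^ j) y) ⟩
    digitSumMod (3 * (3 ^ j * y))  ≤⟨ digitSumMod-3*-≤ (3 ^ j * y) ⟩
    digitSumMod (3 ^ j * y)        ≤⟨ digitSumMod-3^*-≤ j y ⟩
    digitSumMod y                  ∎
    where open ≤-Reasoning

  digitSumMod-+half-wrapped : ∀ j → suc half + j < q-1 →
    digitSumMod (suc half + j + half) + digitSum3 m (suc half + j) ≡ digitSumMod (2 * (suc half + j)) + m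
  digitSumMod-+half-wrapped j r<q-1 = suc-injective (begin
    suc (digitSumMod (r + half) + ds m r)
      ≡⟨ cong (λ x → suc (x + ds m r)) (trans (cong digitSumMod (regroup₁ half j))
                                              (digitSumMod-+[q-1] (suc j) 1+j<q-1)) ⟩
    suc (ds m (suc j) + ds m r)
      ≡⟨ cong (_+ ds m r) (+-comm 1 (ds m (suc j))) ⟩
    ds m (suc j) + 1 + ds m r
      ≡⟨ cong (_+ ds m r) (digitSum3-top m (suc j) 1 (<-trans 1+j<q-1 q-1<3^m) 1<3) ⟨
    ds (suc m) (suc j + 3 ^ m * 1) + ds m r
      ≡⟨ cong (λ x → ds (suc m) (suc j + x * 1) + ds m r) 3^m≡1+[q-1] ⟩
    ds (suc m) (suc j + suc q-1 * 1) + ds m r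
      ≡⟨ cong (λ x → ds (suc m) x + ds m r) (regroup₂ half j) ⟩
    ds (suc m) (1 + (r + half)) + ds m r
      ≡⟨ digitSum3-+repunit m 1 r (s≤s z≤n) (<-trans r<q-1 q-1<3^m) ⟩
    ds (suc m) (1 + 2 * r) + m
      ≡⟨ cong (λ x → ds (suc m) x + m) (regroup₃ half j) ⟩
    ds (suc m) (2 * suc j + suc q-1 * 1) + m
      ≡⟨ cong (λ x → ds (suc m) (2 * suc j + x * 1) + m) 3^m≡1+[q-1] ⟨
    ds (suc m) (2 * suc j + 3 ^ m * 1) + m
      ≡⟨ cong (_+ m) (digitSum3-top m (2 * suc j) 1 (<-trans 2+2j<q-1 q-1<3^m) 1<3) ⟩
    ds m (2 * suc j) + 1 + m
      ≡⟨ cong (_+ m) (+-comm (ds m (2 * suc j)) 1) ⟩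
    suc (ds m (2 * suc j) + m)
      ≡⟨ cong (λ x → suc (x + m)) (trans (cong digitSumMod (regroup₄ half j))
                                         (digitSumMod-+[q-1] (2 * suc j) 2+2j<q-1)) ⟨
    suc (digitSumMod (2 * r) + m) ∎)
    where
    open ≡-Reasoning
    ds = digitSum3
    r = suc half + j
    1<3 : 1 < 3
    1<3 = s≤s (s≤s z≤n)
    1+j<half : suc j < half
    1+j<half = +-cancelˡ-< half (suc j) half (subst (_< q-1) (sym (+-suc half j)) r<q-1)
    1+j<q-1 : suc j < q-1
    1+j<q-1 = <-≤-trans 1+j<half (m≤m+n half half)
    2+2j<q-1 : 2 * suc j < q-1
    2+2j<q-1 = subst (_< q-1) (cong (_+_ (suc j)) (sym (+-identityʳ (suc j)))) (+-mono-< 1+j<half 1+j<half)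
    regroup₁ : ∀ c j → suc c + j + c ≡ suc j + (c + c)
    regroup₁ = solve-∀
    regroup₂ : ∀ c j → suc j + suc (c + c) * 1 ≡ 1 + (suc c + j + c)
    regroup₂ = solve-∀
    regroup₃ : ∀ c j → 1 + 2 * (suc c + j) ≡ 2 * suc j + suc (c + c) * 1
    regroup₃ = solve-∀
    regroup₄ : ∀ c j → 2 * (suc c + j) ≡ 2 * suc j + (c + c)
    regroup₄ = solve-∀

  digitSumMod-+half-residue : ∀ r → r < q-1 →
    digitSumMod (r + half) + digitSum3 m r ≡ digitSumMod (2 * r) + m
  digitSumMod-+half-residue r r<q-1 with <-cmp r half
  ... | tri< r<half _ _ = begin
    digitSumMod (r + half) + digitSum3 m r        ≡⟨ cong (_+ digitSum3 m r) (residue-extend r+half<q-1) ⟨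
    digitSum3 (suc m) (r + half) + digitSum3 m r  ≡⟨ digitSum3-+repunit m 0 r z≤n (<-trans r<q-1 q-1<3^m) ⟩
    digitSum3 (suc m) (2 * r) + m                 ≡⟨ cong (_+ m) (residue-extend 2r<q-1) ⟩
    digitSumMod (2 * r) + m                       ∎
    where
    open ≡-Reasoning
    residue-extend : ∀ {x} → x < q-1 → digitSum3 (suc m) x ≡ digitSumMod x
    residue-extend {x} x<q-1 =
      trans (digitSum3-extend m x (<-trans x<q-1 q-1<3^m)) (sym (digitSumMod-residue x x<q-1))
    r+half<q-1 : r + half < q-1
    r+half<q-1 = +-monoˡ-< half r<half
    2r<q-1 : 2 * r < q-1
    2r<q-1 = subst (_< q-1) (cong (_+_ r) (sym (+-identityʳ r))) (+-mono-< r<half r<half)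
  ... | tri≈ _ refl _ = begin
    digitSumMod q-1 + digitSum3 m half  ≡⟨ cong₂ _+_ digitSumMod-[q-1]≡0 (digitSum3-repunit m) ⟩
    0 + m                               ≡⟨ cong (_+ m) digitSumMod-[q-1]≡0 ⟨
    digitSumMod q-1 + m                 ≡⟨ cong (λ x → digitSumMod (half + x) + m) (+-identityʳ half) ⟨
    digitSumMod (2 * half) + m          ∎
    where open ≡-Reasoning
  ... | tri> _ _ half<r =
    subst (λ x → digitSumMod (x + half) + digitSum3 m x ≡ digitSumMod (2 * x) + m) r≡
          (digitSumMod-+half-wrapped j (subst (_< q-1) (sym r≡) r<q-1))
    where
    j = r ∸ suc half
    r≡ : suc half + j ≡ r
    r≡ = m+[n∸m]≡n half<r

  digitSumMod-+half : ∀ y → digitSumMod (y + half) + digitSumMod y ≡ digitSumMod (2 * y) + m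
  digitSumMod-+half y = begin
    digitSumMod (y + half) + digitSumMod y
      ≡⟨ cong (λ x → digitSum3 m x + digitSumMod y) shift-half ⟩
    digitSumMod (y % q-1 + half) + digitSum3 m (y % q-1)
      ≡⟨ digitSumMod-+half-residue (y % q-1) (m%n<n y q-1) ⟩
    digitSumMod (2 * (y % q-1)) + m
      ≡⟨ cong (λ x → digitSum3 m x + m) ([m*[n%d]]%d≡[m*n]%d 2 y q-1) ⟩
    digitSumMod (2 * y) + m
      ∎
    where
    open ≡-Reasoning
    shift-half : (y + half) % q-1 ≡ (y % q-1 + half) % q-1
    shift-half = trans (%-distribˡ-+ y half q-1)
                       (cong (λ c → (y % q-1 + c) % q-1) (m<n⇒m%n≡m (m<m+n half z<s)))

  m≤digitSumMod+digitSumMod : ∀ j a b → (3 ^ j * (a + 2 * b)) % q-1 ≡ (b + half) % q-1 →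
                              m ≤ digitSumMod a + digitSumMod b
  m≤digitSumMod+digitSumMod j a b rotation≡ = +-cancelˡ-≤ (digitSumMod (2 * b)) m _ (begin
    digitSumMod (2 * b) + m
      ≡⟨ digitSumMod-+half b ⟨
    digitSumMod (b + half) + digitSumMod b
      ≡⟨ cong (λ x → digitSum3 m x + digitSumMod b) rotation≡ ⟨
    digitSumMod (3 ^ j * (a + 2 * b)) + digitSumMod b
      ≤⟨ +-monoˡ-≤ _ (digitSumMod-3^*-≤ j (a + 2 * b)) ⟩
    digitSumMod (a + 2 * b) + digitSumMod b
      ≤⟨ +-monoˡ-≤ _ (digitSumMod-+-≤ a (2 * b)) ⟩
    digitSumMod a + digitSumMod (2 * b) + digitSumMod b
      ≡⟨ xy∙z≈y∙xz (digitSumMod a) _ _ ⟩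
    digitSumMod (2 * b) + (digitSumMod a + digitSumMod b)
      ∎)
    where open ≤-Reasoning

module IntegerResidues where
  open import Data.Nat as ℕ using (zero; suc; NonZero; _%_)
  open import Data.Nat.DivMod using ([m+kn]%n≡m%n)
  open import Data.Integer using (ℤ; +_; -[1+_]; _+_; _*_; _-_; -_; 1ℤ; _%ℕ_)
  open import Data.Integer.Properties using (pos-+; pos-*; +-injective)
  open import Data.Integer.Tactic.RingSolver using (solve-∀)
  open import Data.Product using (∃-syntax; _,_)
  open import Relation.Binary.PropositionalEquality
  open ≡-Reasoning

  pos-+-* : ∀ x k n → + (x ℕ.+ k ℕ.* n) ≡ + x + + k * + n
  pos-+-* x k n = trans (pos-+ x (k ℕ.* n)) (cong (_+_ (+ x)) (pos-* k n))

  +x≡+y+k*+n⇒x%n≡y%n : ∀ {n} .{{_ : NonZero n}} x y (k : ℤ) → + x ≡ + y + k * + n → x % n ≡ y % n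
  +x≡+y+k*+n⇒x%n≡y%n {n} x y (+ k) eq =
    trans (cong (_% n) (+-injective (trans eq (sym (pos-+-* y k n))))) ([m+kn]%n≡m%n y k n)
  +x≡+y+k*+n⇒x%n≡y%n {n} x y -[1+ k ] eq =
    sym (trans (cong (_% n) (+-injective +y≡)) ([m+kn]%n≡m%n x (suc k) n))
    where
    +y≡ : + y ≡ + (x ℕ.+ suc k ℕ.* n)
    +y≡ = begin
      + y                                      ≡⟨ cancel (+ y) (+ suc k) (+ n) ⟩
      + y + - (+ suc k) * + n + + suc k * + n  ≡⟨ cong (_+ + suc k * + n) eq ⟨
      + x + + suc k * + n                      ≡⟨ pos-+-* x (suc k) n ⟨
      + (x ℕ.+ suc k ℕ.* n)                    ∎
      where
      cancel : ∀ y k n → y ≡ y + - k * n + k * n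
      cancel = solve-∀

  s≡digitSum3-%ℕ : ∀ m z n .{{_ : NonZero n}} → 3 ^ m ∸ 1 ≡ n → s m z ≡ digitSum3 m (z %ℕ n)
  s≡digitSum3-%ℕ m z (suc n) eq with 3 ^ m ∸ 1 | eq
  ... | .(suc n) | refl with z %ℕ suc n
  ... | zero  = sym (DigitSum.digitSum3-0 m)
  ... | suc r = refl

  rotation-congruence : ∀ (a r q c b : ℤ) →
    + 3 * (b * b) ≡ + 1 + (c + c) →
    r + q * (c + c) ≡ c - a * (+ 3 * b + + 2) →
    ∃[ k ] b * (a + + 2 * r) ≡ r + c + k * (c + c)
  rotation-congruence a r q c b 3bb≡1+2c r≡ = K , (begin
    b * (a + + 2 * r)
      ≡⟨ expand a r q c b ⟩
    r + c + K * (c + c) + (+ 2 * b - 1ℤ) * (r + q * (c + c) - B) - + 2 * a * (+ 3 * (b * b) - (+ 1 + (c + c)))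
      ≡⟨ cong₂ (λ x y → r + c + K * (c + c) + (+ 2 * b - 1ℤ) * (x - B)
                                           - + 2 * a * (y - (+ 1 + (c + c)))) r≡ 3bb≡1+2c ⟩
    r + c + K * (c + c) + (+ 2 * b - 1ℤ) * (B - B) - + 2 * a * (+ 1 + (c + c) - (+ 1 + (c + c)))
      ≡⟨ cancel (r + c + K * (c + c)) (+ 2 * b - 1ℤ) B (+ 2 * a) (+ 1 + (c + c)) ⟩
    r + c + K * (c + c) ∎)
    where
    B = c - a * (+ 3 * b + + 2)
    K = b - 1ℤ - + 2 * a - (+ 2 * b - 1ℤ) * q
    expand : ∀ a r q c b → b * (a + + 2 * r) ≡
      r + c + (b - 1ℤ - + 2 * a - (+ 2 * b - 1ℤ) * q) * (c + c)
        + (+ 2 * b - 1ℤ) * (r + q * (c + c) - (c - a * (+ 3 * b + + 2)))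
        - + 2 * a * (+ 3 * (b * b) - (+ 1 + (c + c)))
    expand = solve-∀
    cancel : ∀ p s x t y → p + s * (x - x) - t * (y - y) ≡ p
    cancel = solve-∀

module DigitSumBound (h : ℕ) where
  open CyclicDigitSum (2 N.* h)
  open IntegerResidues
  open import Data.Nat as ℕ using (_%_)
  open import Data.Nat.Properties using (^-distribˡ-+-*; +-identityʳ; +-comm)
  open import Data.Integer using (_+_; _*_; _-_; _%ℕ_; _/ℕ_)
  open import Data.Integer.Properties using (pos-+; pos-*)
  open import Data.Integer.DivMod using (a≡a%ℕn+[a/ℕn]*n; n%ℕd<d)
  open import Data.Product using (_,_)
  open import Relation.Binary.PropositionalEquality
  open ≡-Reasoning

  2h+1≡m : 2 N.* h N.+ 1 ≡ m
  2h+1≡m = +-comm (2 N.* h) 1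

  β : ℕ
  β = 3 ^ h

  3ββ≡3^m : 3 ℕ.* (β ℕ.* β) ≡ 3 ^ m
  3ββ≡3^m = cong (3 ℕ.*_) (trans (sym (^-distribˡ-+-* 3 h h))
                                 (cong (λ e → 3 ^ (h ℕ.+ e)) (sym (+-identityʳ h))))

  m≤s+s : ∀ a → m ≤ s m (+ a) ℕ.+ s m (+ half - + a * (+ (3 ^ (h ℕ.+ 1)) + + 2))
  m≤s+s a = subst₂ (λ x y → m ≤ x ℕ.+ y) (sym s-a) (sym s-b)
                   (m≤digitSumMod+digitSumMod h a r rotation≡)
    where
    b = + half - + a * (+ (3 ^ (h ℕ.+ 1)) + + 2)
    r = b %ℕ q-1
    quot = b /ℕ q-1
    s-a : s m (+ a) ≡ digitSumMod a
    s-a = s≡digitSum3-%ℕ m (+ a) q-1 3^m∸1≡q-1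
    s-b : s m b ≡ digitSumMod r
    s-b = trans (s≡digitSum3-%ℕ m b q-1 3^m∸1≡q-1) (sym (digitSumMod-residue r (n%ℕd<d b q-1)))
    α≡3β : + (3 ^ (h ℕ.+ 1)) ≡ + 3 * + β
    α≡3β = trans (cong (λ e → + (3 ^ e)) (+-comm h 1)) (pos-* 3 β)
    3ββ≡1+[q-1] : + 3 * (+ β * + β) ≡ + 1 + (+ half + + half)
    3ββ≡1+[q-1] = begin
      + 3 * (+ β * + β)        ≡⟨ cong (+ 3 *_) (pos-* β β) ⟨
      + 3 * + (β ℕ.* β)        ≡⟨ pos-* 3 (β ℕ.* β) ⟨
      + (3 ℕ.* (β ℕ.* β))      ≡⟨ cong +_ (trans 3ββ≡3^m 3^m≡1+[q-1]) ⟩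
      + (1 ℕ.+ q-1)            ≡⟨ pos-+ 1 q-1 ⟩
      + 1 + + q-1              ≡⟨ cong (_+_ (+ 1)) (pos-+ half half) ⟩
      + 1 + (+ half + + half)  ∎
    r≡ : + r + quot * (+ half + + half) ≡ + half - + a * (+ 3 * + β + + 2)
    r≡ = begin
      + r + quot * (+ half + + half)  ≡⟨ cong (λ n → + r + quot * n) (pos-+ half half) ⟨
      + r + quot * + q-1              ≡⟨ a≡a%ℕn+[a/ℕn]*n b q-1 ⟨
      b                               ≡⟨ cong (λ x → + half - + a * (x + + 2)) α≡3β ⟩
      + half - + a * (+ 3 * + β + + 2) ∎
    rotation≡ : (β ℕ.* (a ℕ.+ 2 ℕ.* r)) % q-1 ≡ (r ℕ.+ half) % q-1
    rotation≡ with rotation-congruence (+ a) (+ r) quot (+ half) (+ β) 3ββ≡1+[q-1] r≡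
    ... | k , ≡r+half+k[q-1] = +x≡+y+k*+n⇒x%n≡y%n _ _ k (begin
      + (β ℕ.* (a ℕ.+ 2 ℕ.* r))             ≡⟨ pos-* β _ ⟩
      + β * + (a ℕ.+ 2 ℕ.* r)               ≡⟨ cong (+ β *_) (pos-+-* a 2 r) ⟩
      + β * (+ a + + 2 * + r)               ≡⟨ ≡r+half+k[q-1] ⟩
      + r + + half + k * (+ half + + half)  ≡⟨ cong₂ (λ x n → x + k * n) (pos-+ r half) (pos-+ half half) ⟨
      + (r ℕ.+ half) + k * + q-1            ∎)

theorem6p1 : (h : ℕ) → (a : ℕ) →
    a ≤ 3 ^ (2 N.* h N.+ 1) ∸ 2 →
    s (2 N.* h N.+ 1) (+ a)
      N.+ s (2 N.* h N.+ 1) (+ ((3 ^ (2 N.* h N.+ 1) ∸ 1) / 2) Z.- (+ a) Z.* (+ (3 ^ (h N.+ 1)) Z.+ + 2))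
      ≥ 2 N.* h N.+ 1
theorem6p1 h a _ rewrite DigitSumBound.2h+1≡m h | CyclicDigitSum.[3^m∸1]/2≡half (2 N.* h) =
  DigitSumBound.m≤s+s h a
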